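{- Let $G$ be a connected triangle-free and quadrangle-free graph with $n$ vertices, $m$ edges and diameter $d$, let $M_1$ be its first Zagreb index, and let $0<\alpha<1$. Put \[ L=\alpha^{d}\bigl(n(n-1)-M_1\bigr)+\alpha^{2}(M_1-2m)+2m\alpha,\qquad U=\alpha^{3}\bigl(n(n-1)-M_1\bigr)+\alpha^{2}(M_1-2m)+2m\alpha . \] Then $L\le GC(G)\le U$, and \[ \frac{n(n-1)-M_1}{2^{d}}+\frac{M_1+2m}{4}\;\le\; C(G)\;\le\;\frac{n(n-1)+M_1+4m}{8}. \] In each formula, equality holds (in both inequalities) if the diameter $d$ is at most $3$.
   Context: All graphs are finite and simple. A graph is triangle-free and quadrangle-free if it contains no cycle of length $3$ and no cycle of length $4$. For vertices $i,j$ of a connected graph $G$, $d(i,j)$ is their distance; the diameter is $\max_{i,j}d(i,j)$. The first Zagreb index is $M_1(G)=\sum_{v\in V(G)} d_v^2$, where $d_v$ is the degree of $v$. The closeness is $C(G)=\sum_{i\in V(G)}\sum_{j\neq i}2^{ -d(i,j)}$, and for fixed $0<\alpha<1$ the generalized closeness is $GC(G)=\sum_{i\in V(G)}\sum_{j\neq i}\alpha^{d(i,j)}$.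
   Formalization: The parameter α of the generalized closeness ranges over the rationals in (0,1) rather than over real numbers. -}

module Defs where

open import Data.Nat as ℕ using (ℕ; zero; suc)
open import Data.Bool using (Bool; true; false; T)
open import Data.Fin using (Fin; _<_)
open import Data.Fin.Properties using (_≟_)
open import Data.List using (List; length; filter; map; allFin; concatMap)
open import Data.Nat.ListAction using (sum)
open import Data.Product using (Σ; ∃; ∃-syntax; _×_; _,_)
open import Relation.Nullary using (¬_; Dec; yes; no)
open import Relation.Binary.PropositionalEquality using (_≡_; _≢_)
open import Data.Integer as ℤ using (ℤ)
open import Data.Rational as ℚ using (ℚ)

record Graph (n : ℕ) : Set where
  field
    adj    : Fin n → Fin n → Bool
    sym    : ∀ i j → adj i j ≡ adj j i
    irrefl : ∀ i → adj i i ≡ false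
open Graph public

Adj : ∀ {n} → Graph n → Fin n → Fin n → Set
Adj G i j = T (adj G i j)

data Walk {n : ℕ} (G : Graph n) : Fin n → Fin n → ℕ → Set where
  here : ∀ {i} → Walk G i i zero
  step : ∀ {i j l k} → Adj G i j → Walk G j l k → Walk G i l (suc k)

Connected : ∀ {n} → Graph n → Set
Connected G = ∀ i j → ∃[ k ] Walk G i j k

TriangleFree : ∀ {n} → Graph n → Set
TriangleFree G = ∀ a b c → ¬ (Adj G a b × Adj G b c × Adj G c a)

QuadrangleFree : ∀ {n} → Graph n → Set
QuadrangleFree G = ∀ a b c d → a ≢ c → b ≢ d →
  ¬ (Adj G a b × Adj G b c × Adj G c d × Adj G d a)

IsDistance : ∀ {n} → Graph n → (Fin n → Fin n → ℕ) → Set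
IsDistance G D = ∀ i j → Walk G i j (D i j) × (∀ k → Walk G i j k → D i j ℕ.≤ k)

IsDiameter : ∀ {n} → (Fin n → Fin n → ℕ) → ℕ → Set
IsDiameter D d = (∀ i j → D i j ℕ.≤ d) × (∃[ i ] ∃[ j ] D i j ≡ d)

degree : ∀ {n} → Graph n → Fin n → ℕ
degree {n} G v = length (filter (λ u → T? (adj G v u)) (allFin n))
  where
  open import Relation.Nullary.Decidable using () renaming (T? to T?)

edgeCount : ∀ {n} → Graph n → ℕ
edgeCount {n} G =
  length (filter (λ p → T? (adj G (Data.Product.proj₁ p) (Data.Product.proj₂ p)))
    (filter (λ p → Data.Fin._<?_ (Data.Product.proj₁ p) (Data.Product.proj₂ p))
      (concatMap (λ i → map (λ j → (i , j)) (allFin n)) (allFin n))))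
  where
  open import Relation.Nullary.Decidable using () renaming (T? to T?)
  import Data.Fin
  import Data.Product

zagreb₁ : ∀ {n} → Graph n → ℕ
zagreb₁ {n} G = sum (map (λ v → degree G v ℕ.* degree G v) (allFin n))

_^_ : ℚ → ℕ → ℚ
x ^ zero  = ℚ.1ℚ
x ^ suc k = x ℚ.* (x ^ k)

sumℚ : List ℚ → ℚ
sumℚ = Data.List.foldr ℚ._+_ ℚ.0ℚ
  where import Data.List

genCloseness : ∀ {n} → ℚ → (Fin n → Fin n → ℕ) → ℚ
genCloseness {n} α D =
  sumℚ (map (λ i → sumℚ (map (λ j → α ^ D i j)
                  (filter (λ j → Relation.Nullary.Decidable.¬? (i ≟ j)) (allFin n))))
            (allFin n))
  where import Relation.Nullary.Decidable

half : ℚ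
half = ℚ.½

closeness : ∀ {n} → (Fin n → Fin n → ℕ) → ℚ
closeness D = genCloseness half D

ι : ℕ → ℚ
ι k = ℚ.mkℚ (ℤ.+ k) 0 (Data.Nat.Coprimality.sym (Data.Nat.Coprimality.1-coprimeTo k))
  where import Data.Nat.Coprimality

-- For i ≠ j write a = A i j for adjacency and p = walks₂ i j for the number of common neighbours.
-- Without triangles and quadrangles, either a = 1, p = 0 and the distance is 1, or a = 0, p = 1 and
-- the distance is 2, or a = p = 0 and the distance lies between 3 and d.  Hence the affine weight
-- β + (α - β) a + (α² - β) p equals α^distance on the first two kinds of pairs and β on the last:
-- it is a lower bound of α^distance for β = α^d, an upper bound for β = α^3, and exact for both when
-- d ≤ 3.  Summing it over the ordered pairs i ≠ j only needs Σ a = 2m and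
-- Σ p = Σ_v d_v² - Σ_v d_v = M₁ - 2m; the closeness is the case α = 1/2.
module Submission where

open import Defs
open import Data.Nat using (ℕ) renaming (_≤_ to _≤ℕ_)
open import Data.Fin using (Fin)
open import Data.Product using (_×_)
open import Data.Rational using (ℚ; 0ℚ; 1ℚ; _+_; _-_; _*_; _<_; _≤_)
open import Relation.Binary.PropositionalEquality using (_≡_)

open import Algebra.Bundles using (CommutativeRing)
open import Data.Bool using (true; false; if_then_else_; T)
open import Data.Empty using (⊥-elim)
open import Data.Fin using (zero; suc; punchIn)
open import Data.Fin.Properties using (_≟_; _<?_; <-cmp; any?; punchInᵢ≢i)
import Data.Integer as ℤ
import Data.Integer.Properties as ℤₚ
open import Data.List using (List; []; _∷_; _++_; map; filter; length; concatMap; allFin; tabulate)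
open import Data.List.Properties using (map-++; map-∘; map-tabulate)
open import Data.List.Relation.Unary.All as All using (All; []; _∷_)
open import Data.List.Relation.Unary.All.Properties using (all-filter)
open import Data.Nat using (zero; suc; z≤n; s≤s)
import Data.Nat as ℕ
import Data.Nat.Properties as ℕₚ
open import Data.Nat.ListAction using () renaming (sum to sumℕ)
open import Data.Product using (_,_; proj₁; proj₂; ∃-syntax)
open import Data.Rational using (nonNegative; *≤*)
open import Data.Rational.Properties as ℚₚ using (+-*-commutativeRing)
open import Data.Rational.Solver using (module +-*-Solver)
import Data.Rational.Unnormalised as ℚᵘ
import Data.Rational.Unnormalised.Properties as ℚᵘₚ
open import Data.Sum using (_⊎_; inj₁; inj₂)
open import Data.Unit using (tt)
open import Function using (_∘_)
open import Relation.Binary.Definitions using (tri<; tri≈; tri>)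
open import Relation.Binary.PropositionalEquality as ≡
  using (refl; trans; cong; cong₂; subst; _≢_; module ≡-Reasoning)
open import Relation.Nullary using (¬_; yes; no; does; ¬?)
open import Relation.Nullary.Decidable using (dec-true; dec-false; T?; _×-dec_)
open import Relation.Unary using (Pred; Decidable)

open import Algebra.Properties.Semiring.Sum (CommutativeRing.semiring +-*-commutativeRing)
  using (sum; sum-syntax; sum-cong-≗; sum-replicate-zero; sum-remove; ∑-distrib-+; ∑-comm;
         *-distribˡ-sum; *-distribʳ-sum)
open +-*-Solver using (solve; _:+_; _:*_; _:-_; _:^_; con; _:=_)

ι-+ : ∀ a b → ι (a ℕ.+ b) ≡ ι a + ι b
ι-+ a b = ℚₚ.toℚᵘ-injective (ℚᵘₚ.≃-trans
  (ℚᵘ.*≡* (cong (ℤ._* ℤ.+ 1) numerators)) (ℚᵘₚ.≃-sym (ℚₚ.toℚᵘ-homo-+ (ι a) (ι b))))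
  where
  numerators : ℤ.+ (a ℕ.+ b) ≡ ℤ.+ a ℤ.* ℤ.+ 1 ℤ.+ ℤ.+ b ℤ.* ℤ.+ 1
  numerators = trans (ℤₚ.pos-+ a b)
    (≡.sym (cong₂ ℤ._+_ (ℤₚ.*-identityʳ (ℤ.+ a)) (ℤₚ.*-identityʳ (ℤ.+ b))))

ι-* : ∀ a b → ι (a ℕ.* b) ≡ ι a * ι b
ι-* a b = ℚₚ.toℚᵘ-injective (ℚᵘₚ.≃-trans
  (ℚᵘ.*≡* (cong (ℤ._* ℤ.+ 1) (ℤₚ.pos-* a b))) (ℚᵘₚ.≃-sym (ℚₚ.toℚᵘ-homo-* (ι a) (ι b))))

ι-suc : ∀ k → ι (suc k) ≡ 1ℚ + ι k
ι-suc = ι-+ 1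

sumℚ-++ : ∀ xs ys → sumℚ (xs ++ ys) ≡ sumℚ xs + sumℚ ys
sumℚ-++ []       ys = ≡.sym (ℚₚ.+-identityˡ (sumℚ ys))
sumℚ-++ (x ∷ xs) ys = trans (cong (x +_) (sumℚ-++ xs ys)) (≡.sym (ℚₚ.+-assoc x (sumℚ xs) (sumℚ ys)))

sumℚ-filter : ∀ {a p} {A : Set a} {P : Pred A p} (P? : Decidable P) (f : A → ℚ) xs →
  sumℚ (map f (filter P? xs)) ≡ sumℚ (map (λ x → if does (P? x) then f x else 0ℚ) xs)
sumℚ-filter P? f [] = refl
sumℚ-filter P? f (x ∷ xs) with does (P? x)
... | true  = cong (f x +_) (sumℚ-filter P? f xs)
... | false = trans (sumℚ-filter P? f xs) (≡.sym (ℚₚ.+-identityˡ _))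

sumℚ-concatMap : ∀ {a b} {A : Set a} {B : Set b} (f : B → ℚ) (g : A → List B) xs →
  sumℚ (map f (concatMap g xs)) ≡ sumℚ (map (λ x → sumℚ (map f (g x))) xs)
sumℚ-concatMap f g []       = refl
sumℚ-concatMap f g (x ∷ xs) = begin
  sumℚ (map f (g x ++ concatMap g xs))
    ≡⟨ cong sumℚ (map-++ f (g x) _) ⟩
  sumℚ (map f (g x) ++ map f (concatMap g xs))
    ≡⟨ sumℚ-++ (map f (g x)) _ ⟩
  sumℚ (map f (g x)) + sumℚ (map f (concatMap g xs))
    ≡⟨ cong (sumℚ (map f (g x)) +_) (sumℚ-concatMap f g xs) ⟩
  sumℚ (map f (g x)) + sumℚ (map (λ x → sumℚ (map f (g x))) xs)
    ∎
  where open ≡-Reasoning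

sumℚ-mono : ∀ {a} {A : Set a} {f g : A → ℚ} {xs} → All (λ x → f x ≤ g x) xs →
  sumℚ (map f xs) ≤ sumℚ (map g xs)
sumℚ-mono []           = ℚₚ.≤-refl
sumℚ-mono (fx≤gx ∷ le) = ℚₚ.+-mono-≤ fx≤gx (sumℚ-mono le)

ι-length : ∀ {a} {A : Set a} (xs : List A) → ι (length xs) ≡ sumℚ (map (λ _ → 1ℚ) xs)
ι-length []       = refl
ι-length (x ∷ xs) = trans (ι-suc (length xs)) (cong (1ℚ +_) (ι-length xs))

ι-sum : ∀ {a} {A : Set a} (f : A → ℕ) xs → ι (sumℕ (map f xs)) ≡ sumℚ (map (ι ∘ f) xs)
ι-sum f []       = refl
ι-sum f (x ∷ xs) = trans (ι-+ (f x) _) (cong (ι (f x) +_) (ι-sum f xs))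

sumℚ-tabulate : ∀ {n} (f : Fin n → ℚ) → sumℚ (tabulate f) ≡ ∑[ i < n ] f i
sumℚ-tabulate {zero}  f = refl
sumℚ-tabulate {suc n} f = cong (f zero +_) (sumℚ-tabulate (f ∘ suc))

sumℚ-allFin : ∀ {n} (f : Fin n → ℚ) → sumℚ (map f (allFin n)) ≡ ∑[ i < n ] f i
sumℚ-allFin {n} f = trans (cong sumℚ (map-tabulate (λ i → i) f)) (sumℚ-tabulate f)

∑-const : ∀ n x → ∑[ i < n ] x ≡ ι n * x
∑-const zero    x = ≡.sym (ℚₚ.*-zeroˡ x)
∑-const (suc n) x = begin
  x + ∑[ i < n ] x     ≡⟨ cong₂ _+_ (≡.sym (ℚₚ.*-identityˡ x)) (∑-const n x) ⟩
  1ℚ * x + ι n * x     ≡⟨ ℚₚ.*-distribʳ-+ x 1ℚ (ι n) ⟨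
  (1ℚ + ι n) * x       ≡⟨ cong (_* x) (ι-suc n) ⟨
  ι (suc n) * x        ∎
  where open ≡-Reasoning

∑-affine : ∀ {n} c a b (f g : Fin n → ℚ) →
  ∑[ i < n ] (c + a * f i + b * g i) ≡ ι n * c + a * ∑[ i < n ] f i + b * ∑[ i < n ] g i
∑-affine {n} c a b f g = begin
  ∑[ i < n ] (c + a * f i + b * g i)
    ≡⟨ ∑-distrib-+ (λ i → c + a * f i) (λ i → b * g i) ⟩
  ∑[ i < n ] (c + a * f i) + ∑[ i < n ] (b * g i)
    ≡⟨ cong (_+ ∑[ i < n ] (b * g i)) (∑-distrib-+ (λ _ → c) (λ i → a * f i)) ⟩
  ∑[ i < n ] c + ∑[ i < n ] (a * f i) + ∑[ i < n ] (b * g i)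
    ≡⟨ cong₂ _+_ (cong₂ _+_ (∑-const n c) (≡.sym (*-distribˡ-sum a f))) (≡.sym (*-distribˡ-sum b g)) ⟩
  ι n * c + a * ∑[ i < n ] f i + b * ∑[ i < n ] g i
    ∎
  where open ≡-Reasoning

∑-mono : ∀ {n} {f g : Fin n → ℚ} → (∀ i → f i ≤ g i) → ∑[ i < n ] f i ≤ ∑[ i < n ] g i
∑-mono {zero}  f≤g = ℚₚ.≤-refl
∑-mono {suc n} f≤g = ℚₚ.+-mono-≤ (f≤g zero) (∑-mono (f≤g ∘ suc))

∑-zero : ∀ {n} {f : Fin n → ℚ} → (∀ i → f i ≡ 0ℚ) → ∑[ i < n ] f i ≡ 0ℚ
∑-zero {n} f≡0 = trans (sum-cong-≗ f≡0) (sum-replicate-zero n)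

∑-single : ∀ {n} (f : Fin n → ℚ) v → (∀ w → w ≢ v → f w ≡ 0ℚ) → ∑[ i < n ] f i ≡ f v
∑-single {suc n} f v vanishes = begin
  sum f                               ≡⟨ sum-remove {i = v} f ⟩
  f v + ∑[ k < n ] f (punchIn v k)    ≡⟨ cong (f v +_) (∑-zero (λ k → vanishes _ (punchInᵢ≢i v k))) ⟩
  f v + 0ℚ                            ≡⟨ ℚₚ.+-identityʳ (f v) ⟩
  f v                                 ∎
  where open ≡-Reasoning

sumExcept : ∀ {n} → Fin n → (Fin n → ℚ) → ℚ
sumExcept {n} i f = sumℚ (map f (filter (λ j → ¬? (i ≟ j)) (allFin n)))

∑-without : ∀ {n} (f : Fin n → ℚ) i →
  ∑[ j < n ] (if does (¬? (i ≟ j)) then f j else 0ℚ) + f i ≡ ∑[ j < n ] f j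
∑-without {suc n} f zero    =
  trans (cong (_+ f zero) (ℚₚ.+-identityˡ (∑[ j < n ] f (suc j)))) (ℚₚ.+-comm (∑[ j < n ] f (suc j)) (f zero))
∑-without {suc n} f (suc i) =
  trans (ℚₚ.+-assoc (f zero) (∑[ j < n ] (if does (¬? (i ≟ j)) then f (suc j) else 0ℚ)) (f (suc i)))
        (cong (f zero +_) (∑-without (f ∘ suc) i))

sumExcept-+ : ∀ {n} i (f : Fin n → ℚ) → sumExcept i f + f i ≡ ∑[ j < n ] f j
sumExcept-+ {n} i f = trans (cong (_+ f i) masked) (∑-without f i)
  where
  masked : sumExcept i f ≡ ∑[ j < n ] (if does (¬? (i ≟ j)) then f j else 0ℚ)
  masked = trans (sumℚ-filter (λ j → ¬? (i ≟ j)) f (allFin n))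
                 (sumℚ-allFin (λ j → if does (¬? (i ≟ j)) then f j else 0ℚ))

sumExcept-mono : ∀ {n} i {f g : Fin n → ℚ} → (∀ j → i ≢ j → f j ≤ g j) → sumExcept i f ≤ sumExcept i g
sumExcept-mono {n} i f≤g = sumℚ-mono (All.map (f≤g _) (all-filter (λ j → ¬? (i ≟ j)) (allFin n)))

offDiagonalSum : ∀ {n} → (Fin n → Fin n → ℚ) → ℚ
offDiagonalSum {n} F = ∑[ i < n ] sumExcept i (F i)

offDiagonalSum-mono : ∀ {n} {F H : Fin n → Fin n → ℚ} → (∀ i j → i ≢ j → F i j ≤ H i j) →
  offDiagonalSum F ≤ offDiagonalSum H
offDiagonalSum-mono F≤H = ∑-mono (λ i → sumExcept-mono i (F≤H i))

offDiagonalSum-+-trace : ∀ {n} (F : Fin n → Fin n → ℚ) →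
  offDiagonalSum F + ∑[ i < n ] F i i ≡ ∑[ i < n ] ∑[ j < n ] F i j
offDiagonalSum-+-trace F =
  trans (≡.sym (∑-distrib-+ (λ i → sumExcept i (F i)) (λ i → F i i))) (sum-cong-≗ (λ i → sumExcept-+ i (F i)))

genCloseness-offDiagonalSum : ∀ {n} α (D : Fin n → Fin n → ℕ) →
  genCloseness α D ≡ offDiagonalSum (λ i j → α ^ D i j)
genCloseness-offDiagonalSum α D = sumℚ-allFin (λ i → sumExcept i (λ j → α ^ D i j))

module _ {α : ℚ} (0≤α : 0ℚ ≤ α) where

  ^-nonNeg : ∀ k → 0ℚ ≤ α ^ k
  ^-nonNeg zero    = ℚₚ.nonNegative⁻¹ 1ℚ
  ^-nonNeg (suc k) =
    subst (_≤ α * α ^ k) (ℚₚ.*-zeroʳ α) (ℚₚ.*-monoˡ-≤-nonNeg α {{nonNegative 0≤α}} (^-nonNeg k))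

  module _ (α≤1 : α ≤ 1ℚ) where

    ^-suc-≤ : ∀ k → α ^ suc k ≤ α ^ k
    ^-suc-≤ k = subst (α * α ^ k ≤_) (ℚₚ.*-identityˡ (α ^ k))
      (ℚₚ.*-monoʳ-≤-nonNeg (α ^ k) {{nonNegative (^-nonNeg k)}} α≤1)

    ^-antitone : ∀ {k l} → k ≤ℕ l → α ^ l ≤ α ^ k
    ^-antitone {l = zero}  z≤n       = ℚₚ.≤-refl
    ^-antitone {l = suc l} z≤n       = ℚₚ.≤-trans (^-suc-≤ l) (^-antitone {l = l} z≤n)
    ^-antitone             (s≤s k≤l) = ℚₚ.*-monoˡ-≤-nonNeg α {{nonNegative 0≤α}} (^-antitone k≤l)

weight : ℚ → ℚ → ℚ → ℚ → ℚ
weight α β a p = β + (α - β) * a + (α ^ 2 - β) * p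

weight-1-0 : ∀ α β → weight α β 1ℚ 0ℚ ≡ α ^ 1
weight-1-0 = solve 2 (λ α β → β :+ (α :- β) :* con 1ℚ :+ (α :^ 2 :- β) :* con 0ℚ := α :^ 1) refl

weight-0-1 : ∀ α β → weight α β 0ℚ 1ℚ ≡ α ^ 2
weight-0-1 = solve 2 (λ α β → β :+ (α :- β) :* con 0ℚ :+ (α :^ 2 :- β) :* con 1ℚ := α :^ 2) refl

weight-0-0 : ∀ α β → weight α β 0ℚ 0ℚ ≡ β
weight-0-0 = solve 2 (λ α β → β :+ (α :- β) :* con 0ℚ :+ (α :^ 2 :- β) :* con 0ℚ := β) refl

formula-from-sums : ∀ α β n m M X →
  X + (n * β + (α - β) * 0ℚ + (α ^ 2 - β) * (ι 2 * m))
    ≡ n * (n * β) + (α - β) * (ι 2 * m) + (α ^ 2 - β) * M →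
  X ≡ β * (n * (n - 1ℚ) - M) + α ^ 2 * (M - ι 2 * m) + ι 2 * m * α
formula-from-sums α β n m M X sums = begin
  X                       ≡⟨ solve 2 (λ X Y → X := X :+ Y :- Y) refl X Y ⟩
  X + Y - Y               ≡⟨ cong (_- Y) sums ⟩
  S - Y                   ≡⟨ solve 5 (λ α β n m M →
                               n :* (n :* β) :+ (α :- β) :* (con (ι 2) :* m) :+ (α :^ 2 :- β) :* M
                                 :- (n :* β :+ (α :- β) :* con 0ℚ :+ (α :^ 2 :- β) :* (con (ι 2) :* m))
                               := β :* (n :* (n :- con 1ℚ) :- M) :+ α :^ 2 :* (M :- con (ι 2) :* m)
                                 :+ con (ι 2) :* m :* α) refl α β n m M ⟩
  β * (n * (n - 1ℚ) - M) + α ^ 2 * (M - ι 2 * m) + ι 2 * m * α ∎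
  where
  open ≡-Reasoning
  Y S : ℚ
  Y = n * β + (α - β) * 0ℚ + (α ^ 2 - β) * (ι 2 * m)
  S = n * (n * β) + (α - β) * (ι 2 * m) + (α ^ 2 - β) * M

formula-½-lower : ∀ β X M m →
  β * (X - M) + half ^ 2 * (M - ι 2 * m) + ι 2 * m * half ≡ β * (X - M) + half ^ 2 * (M + ι 2 * m)
formula-½-lower = solve 4 (λ β X M m →
  β :* (X :- M) :+ con half :^ 2 :* (M :- con (ι 2) :* m) :+ con (ι 2) :* m :* con half
  := β :* (X :- M) :+ con half :^ 2 :* (M :+ con (ι 2) :* m)) refl

formula-½-upper : ∀ X M m →
  half ^ 3 * (X - M) + half ^ 2 * (M - ι 2 * m) + ι 2 * m * half ≡ half ^ 3 * (X + M + ι 4 * m)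
formula-½-upper = solve 3 (λ X M m →
  con half :^ 3 :* (X :- M) :+ con half :^ 2 :* (M :- con (ι 2) :* m)
    :+ con (ι 2) :* m :* con half
  := con half :^ 3 :* (X :+ M :+ con (ι 4) :* m)) refl

0≤½ : 0ℚ ≤ half
0≤½ = ℚₚ.nonNegative⁻¹ half

½≤1 : half ≤ 1ℚ
½≤1 = *≤* (ℤ.+≤+ (s≤s z≤n))

module _ {n} (G : Graph n) where

  A : Fin n → Fin n → ℚ
  A i j = if adj G i j then 1ℚ else 0ℚ

  A-sym : ∀ i j → A i j ≡ A j i
  A-sym i j = cong (λ b → if b then 1ℚ else 0ℚ) (Graph.sym G i j)

  A-irrefl : ∀ i → A i i ≡ 0ℚ
  A-irrefl i = cong (λ b → if b then 1ℚ else 0ℚ) (irrefl G i)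

  A-adj : ∀ {i j} → Adj G i j → A i j ≡ 1ℚ
  A-adj {i} {j} i~j with adj G i j
  ... | true  = refl
  ... | false = ⊥-elim i~j

  A-nonadj : ∀ {i j} → ¬ Adj G i j → A i j ≡ 0ℚ
  A-nonadj {i} {j} i≁j with adj G i j
  ... | true  = ⊥-elim (i≁j tt)
  ... | false = refl

  A-idem : ∀ i v → A i v * A v i ≡ A i v
  A-idem i v rewrite Graph.sym G v i with adj G i v
  ... | true  = refl
  ... | false = refl

  A*A-common-or-zero : ∀ i v j → (Adj G i v × Adj G v j) ⊎ A i v * A v j ≡ 0ℚ
  A*A-common-or-zero i v j with adj G i v | adj G v j
  ... | true  | true  = inj₁ (tt , tt)
  ... | true  | false = inj₂ refl
  ... | false | true  = inj₂ refl
  ... | false | false = inj₂ refl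

  walks₂ : Fin n → Fin n → ℚ
  walks₂ i j = ∑[ v < n ] (A i v * A v j)

  walks₂-diag : ∀ i → walks₂ i i ≡ ∑[ v < n ] A i v
  walks₂-diag i = sum-cong-≗ (A-idem i)

  walks₂-none : ∀ {i j} → (∀ v → ¬ (Adj G i v × Adj G v j)) → walks₂ i j ≡ 0ℚ
  walks₂-none {i} {j} none = ∑-zero term
    where
    term : ∀ v → A i v * A v j ≡ 0ℚ
    term v with A*A-common-or-zero i v j
    ... | inj₁ common = ⊥-elim (none v common)
    ... | inj₂ vanishes = vanishes

  walks₂-unique : ∀ {i j v} → Adj G i v → Adj G v j →
    (∀ w → Adj G i w → Adj G w j → w ≡ v) → walks₂ i j ≡ 1ℚ
  walks₂-unique {i} {j} {v} i~v v~j unique =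
    trans (∑-single (λ w → A i w * A w j) v term) (cong₂ _*_ (A-adj i~v) (A-adj v~j))
    where
    term : ∀ w → w ≢ v → A i w * A w j ≡ 0ℚ
    term w w≢v with A*A-common-or-zero i w j
    ... | inj₁ (i~w , w~j) = ⊥-elim (w≢v (unique w i~w w~j))
    ... | inj₂ vanishes    = vanishes

  degree-∑ : ∀ v → ι (degree G v) ≡ ∑[ u < n ] A v u
  degree-∑ v = trans (ι-length (filter (λ u → T? (adj G v u)) (allFin n)))
    (trans (sumℚ-filter (λ u → T? (adj G v u)) (λ _ → 1ℚ) (allFin n)) (sumℚ-allFin (A v)))

  zagreb₁-∑ : ι (zagreb₁ G) ≡ ∑[ v < n ] ((∑[ u < n ] A v u) * (∑[ u < n ] A v u))
  zagreb₁-∑ = trans (ι-sum (λ v → degree G v ℕ.* degree G v) (allFin n))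
    (trans (sumℚ-allFin (λ v → ι (degree G v ℕ.* degree G v)))
      (sum-cong-≗ (λ v → trans (ι-* (degree G v) (degree G v)) (cong₂ _*_ (degree-∑ v) (degree-∑ v)))))

  upper : Fin n → Fin n → ℚ
  upper i j = if does (i <? j) then A i j else 0ℚ

  edgeCount-∑ : ι (edgeCount G) ≡ ∑[ i < n ] ∑[ j < n ] upper i j
  edgeCount-∑ = begin
    ι (edgeCount G)
      ≡⟨ ι-length (filter adjacent? (filter ordered? pairs)) ⟩
    sumℚ (map (λ _ → 1ℚ) (filter adjacent? (filter ordered? pairs)))
      ≡⟨ sumℚ-filter adjacent? (λ _ → 1ℚ) (filter ordered? pairs) ⟩
    sumℚ (map (λ p → A (proj₁ p) (proj₂ p)) (filter ordered? pairs))
      ≡⟨ sumℚ-filter ordered? (λ p → A (proj₁ p) (proj₂ p)) pairs ⟩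
    sumℚ (map (λ p → upper (proj₁ p) (proj₂ p)) pairs)
      ≡⟨ sumℚ-concatMap (λ p → upper (proj₁ p) (proj₂ p)) row (allFin n) ⟩
    sumℚ (map (λ i → sumℚ (map (λ p → upper (proj₁ p) (proj₂ p)) (row i))) (allFin n))
      ≡⟨ sumℚ-allFin (λ i → sumℚ (map (λ p → upper (proj₁ p) (proj₂ p)) (row i))) ⟩
    ∑[ i < n ] sumℚ (map (λ p → upper (proj₁ p) (proj₂ p)) (row i))
      ≡⟨ sum-cong-≗ (λ i → trans (cong sumℚ (≡.sym (map-∘ (allFin n)))) (sumℚ-allFin (upper i))) ⟩
    ∑[ i < n ] ∑[ j < n ] upper i j
      ∎
    where
    open ≡-Reasoning
    row : Fin n → List (Fin n × Fin n)
    row i = map (λ j → (i , j)) (allFin n)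
    pairs : List (Fin n × Fin n)
    pairs = concatMap row (allFin n)
    ordered? : Decidable (λ (p : Fin n × Fin n) → proj₁ p Data.Fin.< proj₂ p)
    ordered? p = proj₁ p <? proj₂ p
    adjacent? : Decidable (λ (p : Fin n × Fin n) → Adj G (proj₁ p) (proj₂ p))
    adjacent? p = T? (adj G (proj₁ p) (proj₂ p))

  A-split : ∀ i j → A i j ≡ upper i j + upper j i
  A-split i j with <-cmp i j
  ... | tri< i<j _ j≮i rewrite dec-true (i <? j) i<j | dec-false (j <? i) j≮i =
    ≡.sym (ℚₚ.+-identityʳ (A i j))
  ... | tri> i≮j _ j<i rewrite dec-false (i <? j) i≮j | dec-true (j <? i) j<i =
    trans (A-sym i j) (≡.sym (ℚₚ.+-identityˡ (A j i)))
  ... | tri≈ i≮i refl _ rewrite dec-false (i <? i) i≮i = A-irrefl i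

  handshake : ∑[ i < n ] ∑[ j < n ] A i j ≡ ι 2 * ι (edgeCount G)
  handshake = begin
    ∑[ i < n ] ∑[ j < n ] A i j
      ≡⟨ sum-cong-≗ (λ i → trans (sum-cong-≗ (A-split i)) (∑-distrib-+ (upper i) (λ j → upper j i))) ⟩
    ∑[ i < n ] (∑[ j < n ] upper i j + ∑[ j < n ] upper j i)
      ≡⟨ ∑-distrib-+ (λ i → ∑[ j < n ] upper i j) (λ i → ∑[ j < n ] upper j i) ⟩
    E + ∑[ i < n ] ∑[ j < n ] upper j i
      ≡⟨ cong (E +_) (∑-comm (λ i j → upper j i)) ⟩
    E + E
      ≡⟨ cong (λ x → x + x) edgeCount-∑ ⟨
    ι (edgeCount G) + ι (edgeCount G)
      ≡⟨ solve 1 (λ x → x :+ x := con (ι 2) :* x) refl (ι (edgeCount G)) ⟩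
    ι 2 * ι (edgeCount G)
      ∎
    where
    open ≡-Reasoning
    E : ℚ
    E = ∑[ i < n ] ∑[ j < n ] upper i j

  walks₂-total : ∑[ i < n ] ∑[ j < n ] walks₂ i j ≡ ι (zagreb₁ G)
  walks₂-total = begin
    ∑[ i < n ] ∑[ j < n ] ∑[ v < n ] (A i v * A v j)
      ≡⟨ sum-cong-≗ (λ i → ∑-comm (λ j v → A i v * A v j)) ⟩
    ∑[ i < n ] ∑[ v < n ] ∑[ j < n ] (A i v * A v j)
      ≡⟨ sum-cong-≗ (λ i → sum-cong-≗ (λ v → *-distribˡ-sum (A i v) (A v))) ⟨
    ∑[ i < n ] ∑[ v < n ] (A i v * deg v)
      ≡⟨ ∑-comm (λ i v → A i v * deg v) ⟩
    ∑[ v < n ] ∑[ i < n ] (A i v * deg v)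
      ≡⟨ sum-cong-≗ (λ v → *-distribʳ-sum (deg v) (λ i → A i v)) ⟨
    ∑[ v < n ] ((∑[ i < n ] A i v) * deg v)
      ≡⟨ sum-cong-≗ (λ v → cong (_* deg v) (sum-cong-≗ (λ i → A-sym i v))) ⟩
    ∑[ v < n ] (deg v * deg v)
      ≡⟨ zagreb₁-∑ ⟨
    ι (zagreb₁ G)
      ∎
    where
    open ≡-Reasoning
    deg : Fin n → ℚ
    deg v = ∑[ u < n ] A v u

  m M₁ N : ℚ
  m  = ι (edgeCount G)
  M₁ = ι (zagreb₁ G)
  N  = ι n * (ι n - 1ℚ)

  formula : ℚ → ℚ → ℚ
  formula α β = β * (N - M₁) + α ^ 2 * (M₁ - ι 2 * m) + ι 2 * m * α

  offDiagonalSum-weight : ∀ α β → offDiagonalSum (λ i j → weight α β (A i j) (walks₂ i j)) ≡ formula α β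
  offDiagonalSum-weight α β = formula-from-sums α β (ι n) m M₁ _
    (trans (cong (offDiagonalSum W +_) (≡.sym trace)) (trans (offDiagonalSum-+-trace W) total))
    where
    W : Fin n → Fin n → ℚ
    W i j = weight α β (A i j) (walks₂ i j)
    total : ∑[ i < n ] ∑[ j < n ] W i j
          ≡ ι n * (ι n * β) + (α - β) * (ι 2 * m) + (α ^ 2 - β) * M₁
    total = trans (sum-cong-≗ (λ i → ∑-affine β (α - β) (α ^ 2 - β) (A i) (walks₂ i)))
      (trans (∑-affine (ι n * β) (α - β) (α ^ 2 - β)
                       (λ i → ∑[ j < n ] A i j) (λ i → ∑[ j < n ] walks₂ i j))
        (cong₂ (λ x y → ι n * (ι n * β) + (α - β) * x + (α ^ 2 - β) * y) handshake walks₂-total))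
    trace : ∑[ i < n ] W i i ≡ ι n * β + (α - β) * 0ℚ + (α ^ 2 - β) * (ι 2 * m)
    trace = trans (∑-affine β (α - β) (α ^ 2 - β) (λ i → A i i) (λ i → walks₂ i i))
      (cong₂ (λ x y → ι n * β + (α - β) * x + (α ^ 2 - β) * y)
        (∑-zero A-irrefl) (trans (sum-cong-≗ walks₂-diag) handshake))

  Adj-sym : ∀ {i j} → Adj G i j → Adj G j i
  Adj-sym {i} {j} = subst T (Graph.sym G i j)

  walk-0 : ∀ {i j} → Walk G i j 0 → i ≡ j
  walk-0 here = refl

  walk-1 : ∀ {i j} → Walk G i j 1 → Adj G i j
  walk-1 (step i~j here) = i~j

  walk-2 : ∀ {i j} → Walk G i j 2 → ∃[ v ] (Adj G i v × Adj G v j)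
  walk-2 (step i~v (step v~j here)) = _ , i~v , v~j

  common-neighbour-unique : QuadrangleFree G → ∀ {i j v w} → i ≢ j →
    Adj G i v → Adj G v j → Adj G i w → Adj G w j → w ≡ v
  common-neighbour-unique qf {i} {j} {v} {w} i≢j i~v v~j i~w w~j with v ≟ w
  ... | yes v≡w = ≡.sym v≡w
  ... | no  v≢w = ⊥-elim (qf i v j w i≢j v≢w (i~v , v~j , Adj-sym w~j , Adj-sym i~w))

  module _ {D : Fin n → Fin n → ℕ} (isD : IsDistance G D) where

    distance-≤ : ∀ {i j k} → Walk G i j k → D i j ≤ℕ k
    distance-≤ {i} {j} {k} = proj₂ (isD i j) k

    distance-adjacent : ∀ {i j} → i ≢ j → Adj G i j → D i j ≡ 1
    distance-adjacent {i} {j} i≢j i~j with D i j | proj₁ (isD i j) | distance-≤ (step i~j here)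
    ... | 0           | w | _       = ⊥-elim (i≢j (walk-0 w))
    ... | 1           | _ | _       = refl
    ... | suc (suc _) | _ | s≤s ()

    distance-common-neighbour : ∀ {i j v} → i ≢ j → ¬ Adj G i j → Adj G i v → Adj G v j → D i j ≡ 2
    distance-common-neighbour {i} {j} i≢j i≁j i~v v~j
      with D i j | proj₁ (isD i j) | distance-≤ (step i~v (step v~j here))
    ... | 0                 | w | _             = ⊥-elim (i≢j (walk-0 w))
    ... | 1                 | w | _             = ⊥-elim (i≁j (walk-1 w))
    ... | 2                 | _ | _             = refl
    ... | suc (suc (suc _)) | _ | s≤s (s≤s ())

    distance-far : ∀ {i j} → i ≢ j → ¬ Adj G i j → (∀ v → ¬ (Adj G i v × Adj G v j)) → 3 ≤ℕ D i j
    distance-far {i} {j} i≢j i≁j none with D i j | proj₁ (isD i j)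
    ... | 0                 | w = ⊥-elim (i≢j (walk-0 w))
    ... | 1                 | w = ⊥-elim (i≁j (walk-1 w))
    ... | 2                 | w = ⊥-elim (none _ (proj₂ (walk-2 w)))
    ... | suc (suc (suc _)) | _ = s≤s (s≤s (s≤s z≤n))

    data PairType (i j : Fin n) : Set where
      adjacent    : A i j ≡ 1ℚ → walks₂ i j ≡ 0ℚ → D i j ≡ 1 → PairType i j
      atDistance2 : A i j ≡ 0ℚ → walks₂ i j ≡ 1ℚ → D i j ≡ 2 → PairType i j
      far         : A i j ≡ 0ℚ → walks₂ i j ≡ 0ℚ → 3 ≤ℕ D i j → PairType i j

    pairType : TriangleFree G → QuadrangleFree G → ∀ {i j} → i ≢ j → PairType i j
    pairType tf qf {i} {j} i≢j with T? (adj G i j)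
    ... | yes i~j = adjacent (A-adj i~j)
      (walks₂-none (λ v (i~v , v~j) → tf i v j (i~v , v~j , Adj-sym i~j)))
      (distance-adjacent i≢j i~j)
    ... | no i≁j with any? (λ v → T? (adj G i v) ×-dec T? (adj G v j))
    ...   | yes (v , i~v , v~j) = atDistance2 (A-nonadj i≁j)
      (walks₂-unique i~v v~j (λ w i~w w~j → common-neighbour-unique qf i≢j i~v v~j i~w w~j))
      (distance-common-neighbour i≢j i≁j i~v v~j)
    ...   | no none = far (A-nonadj i≁j)
      (walks₂-none (λ v common → none (v , common)))
      (distance-far i≢j i≁j (λ v common → none (v , common)))

    module _ (tf : TriangleFree G) (qf : QuadrangleFree G) {α : ℚ} (0≤α : 0ℚ ≤ α) (α≤1 : α ≤ 1ℚ) where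

      pairWeight : ℚ → Fin n → Fin n → ℚ
      pairWeight β i j = weight α β (A i j) (walks₂ i j)

      pairWeight-cases : ∀ β {i j} → i ≢ j →
        pairWeight β i j ≡ α ^ D i j ⊎ (3 ≤ℕ D i j × pairWeight β i j ≡ β)
      pairWeight-cases β i≢j with pairType tf qf i≢j
      ... | adjacent    a p d rewrite a | p | d = inj₁ (weight-1-0 α β)
      ... | atDistance2 a p d rewrite a | p | d = inj₁ (weight-0-1 α β)
      ... | far         a p d rewrite a | p     = inj₂ (d , weight-0-0 α β)

      genCloseness-≥ : ∀ k → (∀ i j → D i j ≤ℕ k) → formula α (α ^ k) ≤ genCloseness α D
      genCloseness-≥ k D≤k = begin
        formula α (α ^ k)                    ≡⟨ offDiagonalSum-weight α (α ^ k) ⟨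
        offDiagonalSum (pairWeight (α ^ k))  ≤⟨ offDiagonalSum-mono below ⟩
        offDiagonalSum (λ i j → α ^ D i j)   ≡⟨ genCloseness-offDiagonalSum α D ⟨
        genCloseness α D                     ∎
        where
        open ℚₚ.≤-Reasoning
        below : ∀ i j → i ≢ j → pairWeight (α ^ k) i j ≤ α ^ D i j
        below i j i≢j with pairWeight-cases (α ^ k) i≢j
        ... | inj₁ exact      = ℚₚ.≤-reflexive exact
        ... | inj₂ (_ , w≡β)  = subst (_≤ α ^ D i j) (≡.sym w≡β) (^-antitone 0≤α α≤1 (D≤k i j))

      genCloseness-≤ : ∀ k → k ≤ℕ 3 → genCloseness α D ≤ formula α (α ^ k)
      genCloseness-≤ k k≤3 = begin
        genCloseness α D                     ≡⟨ genCloseness-offDiagonalSum α D ⟩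
        offDiagonalSum (λ i j → α ^ D i j)   ≤⟨ offDiagonalSum-mono above ⟩
        offDiagonalSum (pairWeight (α ^ k))  ≡⟨ offDiagonalSum-weight α (α ^ k) ⟩
        formula α (α ^ k)                    ∎
        where
        open ℚₚ.≤-Reasoning
        above : ∀ i j → i ≢ j → α ^ D i j ≤ pairWeight (α ^ k) i j
        above i j i≢j with pairWeight-cases (α ^ k) i≢j
        ... | inj₁ exact       = ℚₚ.≤-reflexive (≡.sym exact)
        ... | inj₂ (3≤D , w≡β) =
          subst (α ^ D i j ≤_) (≡.sym w≡β) (^-antitone 0≤α α≤1 (ℕₚ.≤-trans k≤3 3≤D))

      genCloseness-bounds : ∀ {d} → (∀ i j → D i j ≤ℕ d) →
        (formula α (α ^ d) ≤ genCloseness α D × genCloseness α D ≤ formula α (α ^ 3)) ×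
        (d ≤ℕ 3 → genCloseness α D ≡ formula α (α ^ d) × genCloseness α D ≡ formula α (α ^ 3))
      genCloseness-bounds {d} D≤d =
        (genCloseness-≥ d D≤d , genCloseness-≤ 3 ℕₚ.≤-refl) ,
        λ d≤3 → ℚₚ.≤-antisym (genCloseness-≤ d d≤3) (genCloseness-≥ d D≤d) ,
                ℚₚ.≤-antisym (genCloseness-≤ 3 ℕₚ.≤-refl)
                             (genCloseness-≥ 3 (λ i j → ℕₚ.≤-trans (D≤d i j) d≤3))

    closeness-bounds : TriangleFree G → QuadrangleFree G → ∀ {d} → (∀ i j → D i j ≤ℕ d) →
      let Lc = half ^ d * (N - M₁) + half ^ 2 * (M₁ + ι 2 * m)
          Uc = half ^ 3 * (N + M₁ + ι 4 * m)
      in (Lc ≤ closeness D × closeness D ≤ Uc) × (d ≤ℕ 3 → closeness D ≡ Lc × closeness D ≡ Uc)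
    closeness-bounds tf qf {d} D≤d =
      (subst (_≤ closeness D) lowerForm (proj₁ (proj₁ GC)) ,
       subst (closeness D ≤_) upperForm (proj₂ (proj₁ GC))) ,
      λ d≤3 → trans (proj₁ (proj₂ GC d≤3)) lowerForm , trans (proj₂ (proj₂ GC d≤3)) upperForm
      where
      GC : (formula half (half ^ d) ≤ closeness D × closeness D ≤ formula half (half ^ 3)) ×
           (d ≤ℕ 3 → closeness D ≡ formula half (half ^ d) × closeness D ≡ formula half (half ^ 3))
      GC = genCloseness-bounds tf qf 0≤½ ½≤1 D≤d
      lowerForm : formula half (half ^ d) ≡ half ^ d * (N - M₁) + half ^ 2 * (M₁ + ι 2 * m)
      lowerForm = formula-½-lower (half ^ d) N M₁ m
      upperForm : formula half (half ^ 3) ≡ half ^ 3 * (N + M₁ + ι 4 * m)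
      upperForm = formula-½-upper N M₁ m

theorem3p3 : ∀ {n} (G : Graph n) (D : Fin n → Fin n → ℕ) (d : ℕ) (α : ℚ) →
    Connected G → TriangleFree G → QuadrangleFree G →
    IsDistance G D → IsDiameter D d →
    0ℚ < α → α < 1ℚ →
    let m  = ι (edgeCount G)
        M₁ = ι (zagreb₁ G)
        N  = ι n * (ι n - 1ℚ)
        L  = α ^ d * (N - M₁) + α ^ 2 * (M₁ - (ι 2 * m)) + ι 2 * m * α
        U  = α ^ 3 * (N - M₁) + α ^ 2 * (M₁ - (ι 2 * m)) + ι 2 * m * α
        Lc = half ^ d * (N - M₁) + half ^ 2 * (M₁ + ι 2 * m)
        Uc = half ^ 3 * (N + M₁ + ι 4 * m)
        GC = genCloseness α D
        C  = closeness D
    in (L ≤ GC × GC ≤ U) × (Lc ≤ C × C ≤ Uc) ×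
       (d ≤ℕ 3 → (GC ≡ L × GC ≡ U) × (C ≡ Lc × C ≡ Uc))
theorem3p3 G D d α _ tf qf isD (D≤d , _) 0<α α<1 =
  let GC = genCloseness-bounds G isD tf qf (ℚₚ.<⇒≤ 0<α) (ℚₚ.<⇒≤ α<1) D≤d
      C  = closeness-bounds G isD tf qf D≤d
  in proj₁ GC , proj₁ C , λ d≤3 → proj₂ GC d≤3 , proj₂ C d≤3
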